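{- Let $\lambda$ and $\mu$ be partitions with $\lambda \sqsubseteq \mu$ and $|\mu| - |\lambda| > 1$. Then there exists a partition $\mu'$ with $\lambda \sqsubseteq \mu' \sqsubseteq \mu$ and $|\mu| - |\mu'| = 1$.
   Context: A partition $\lambda=(\lambda_1,\ldots,\lambda_k)$ is a weakly decreasing sequence of positive integers (the empty partition is allowed); $|\lambda|=\sum_i\lambda_i$, and $\lambda$ is regarded as extended by trailing zeros when convenient. The conjugate partition $\lambda^*$ is given by $\lambda^*_i = |\{j : \lambda_j \ge i\}|$. For partitions $\lambda,\mu$, $\lambda \trianglelefteq \mu$ means $\sum_{i=1}^k \lambda_i \le \sum_{i=1}^k \mu_i$ for all $k\ge 1$. We write $\lambda \sqsubseteq \mu$ ($\mu$ doubly dominates $\lambda$) if both $\lambda \trianglelefteq \mu$ and $\lambda^* \trianglelefteq \mu^*$. -}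

module Defs where

open import Data.Nat using (ℕ; zero; suc; _+_; _≤_; _<_; _≥_)
open import Data.Nat.ListAction using (sum)
open import Data.List using (List; []; _∷_; take; length; filter; map; upTo)
open import Data.List.Relation.Unary.All using (All)
open import Data.List.Relation.Unary.Linked using (Linked)
open import Data.Nat.Properties using (_≤?_)

record Partition : Set where
  constructor mkPartition
  field
    parts    : List ℕ
    positive : All (λ x → 0 < x) parts
    decr     : Linked _≥_ parts

open Partition public

∣_∣ₚ : Partition → ℕ
∣ p ∣ₚ = sum (parts p)

partialSum : List ℕ → ℕ → ℕ
partialSum xs k = sum (take k xs)

-- Conjugate: λ*_i = #{ j : λ_j ≥ i }, for i = 1 .. λ_1 (entries beyond are 0).
conjParts : List ℕ → List ℕ
conjParts [] = []
conjParts (x ∷ xs) = map (λ i → length (filter (λ y → suc i ≤? y) (x ∷ xs))) (upTo x)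

_⊴_ : List ℕ → List ℕ → Set
l ⊴ m = ∀ k → 1 ≤ k → partialSum l k ≤ partialSum m k

_⊑_ : Partition → Partition → Set
l ⊑ m = (parts l ⊴ parts m) × (conjParts (parts l) ⊴ conjParts (parts m))
  where open import Data.Product using (_×_)

-- Write P_ν(k) = ν₁ + … + ν_k.  Partial sums of the conjugate are
-- ν*₁ + … + ν*_c = Σᵢ min(νᵢ, c) = min_k (k·c + |ν| − P_ν(k)), so for partitions
-- λ* ⊴ μ* holds iff |λ| − P_λ(k) ≤ |μ| − P_μ(k) for every k: conjugate dominance is
-- dominance of the tails.  With e = |μ| − |λ| − 1, the function
-- f(k) = min(P_μ(k), P_λ(k) + e) is increasing and concave, being a minimum of two
-- such functions, so it is the partial-sum function of a partition μ′ with |μ′| = |μ| − 1.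
-- Then λ ⊴ μ′ ⊴ μ is immediate, and the tail conditions reduce to f ≤ P_λ + e and
-- P_μ ≤ f + 1, the latter because the tails of λ are bounded by those of μ.
module Submission where

open import Defs
open import Algebra.Properties.CommutativeSemigroup as CSProps using ()
open import Data.Bool using (true; false; if_then_else_)
open import Data.List using (List; []; _∷_; take; length; filter; map; upTo; applyUpTo)
open import Data.List.Properties using (map-upTo; take-all; take-take; take-[])
open import Data.List.Relation.Unary.All using (All; []; _∷_)
import Data.List.Relation.Unary.All as All
open import Data.List.Relation.Unary.All.Properties using (all-filter)
open import Data.List.Relation.Unary.Linked using (Linked; []; [-]; _∷_)
open import Data.List.Relation.Unary.Linked.Properties using (Linked⇒All; filter⁺)
import Data.List.Relation.Unary.Linked as Linked
open import Data.Nat using (ℕ; zero; suc; _+_; _*_; _∸_; _⊓_; _≤_; _<_; _≥_; z≤n; s≤s)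
open import Data.Nat.ListAction using (sum)
open import Data.Nat.Properties
open import Data.Product using (Σ; ∃-syntax; _×_; _,_)
open import Data.Sum using (inj₁; inj₂)
open import Function using (_∘_; flip)
open import Relation.Nullary using (does; yes; no)
open import Relation.Binary.PropositionalEquality

open CSProps +-commutativeSemigroup using (interchange; xy∙z≈y∙xz; xy∙z≈x∙zy; xy∙z≈xz∙y; x∙yz≈z∙yx; x∙yz≈xz∙y)

Decreasing : List ℕ → Set
Decreasing = Linked _≥_

Increasing : (ℕ → ℕ) → Set
Increasing f = ∀ i → f i ≤ f (suc i)

Concave : (ℕ → ℕ) → Set
Concave f = ∀ i → f (2 + i) + f i ≤ f (1 + i) + f (1 + i)

decreasing⇒bounded : ∀ {x xs} → Decreasing (x ∷ xs) → All (_≤ x) (x ∷ xs)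
decreasing⇒bounded = Linked⇒All (flip ≤-trans) ≤-refl

partialSum-[] : ∀ k → partialSum [] k ≡ 0
partialSum-[] k = cong sum (take-[] k)

partialSum-⊓ : ∀ xs {N} → length xs ≤ N → ∀ k → partialSum xs (k ⊓ N) ≡ partialSum xs k
partialSum-⊓ xs {N} len≤N k = cong sum (begin
    take (k ⊓ N) xs        ≡⟨ take-take k N xs ⟨
    take k (take N xs)     ≡⟨ cong (take k) (take-all N xs len≤N) ⟩
    take k xs              ∎)
  where open ≡-Reasoning

partialSum-all : ∀ xs {N} → length xs ≤ N → partialSum xs N ≡ sum xs
partialSum-all xs {N} len≤N = cong sum (take-all N xs len≤N)

at : List ℕ → ℕ → ℕ
at []       k       = 0
at (x ∷ xs) zero    = x
at (x ∷ xs) (suc k) = at xs k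

partialSum-suc : ∀ xs k → partialSum xs (suc k) ≡ partialSum xs k + at xs k
partialSum-suc []       k       = sym (trans (+-identityʳ _) (partialSum-[] k))
partialSum-suc (x ∷ xs) zero    = +-identityʳ x
partialSum-suc (x ∷ xs) (suc k) = trans (cong (x +_) (partialSum-suc xs k)) (sym (+-assoc x _ _))

at-decreasing : ∀ {xs} → Decreasing xs → ∀ k → at xs (suc k) ≤ at xs k
at-decreasing []        k       = z≤n
at-decreasing [-]       k       = z≤n
at-decreasing (x≥y ∷ _) zero    = x≥y
at-decreasing (_ ∷ dec) (suc k) = at-decreasing dec k

partialSum-increasing : ∀ xs → Increasing (partialSum xs)
partialSum-increasing xs k = subst (partialSum xs k ≤_) (sym (partialSum-suc xs k)) (m≤m+n _ _)

partialSum-concave : ∀ {xs} → Decreasing xs → Concave (partialSum xs)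
partialSum-concave {xs} dec k = begin
    partialSum xs (2 + k) + P₀  ≡⟨ cong (_+ P₀) (partialSum-suc xs (suc k)) ⟩
    (P₁ + at xs (suc k)) + P₀   ≡⟨ +-assoc P₁ _ P₀ ⟩
    P₁ + (at xs (suc k) + P₀)   ≤⟨ +-monoʳ-≤ P₁ (+-monoˡ-≤ P₀ (at-decreasing dec k)) ⟩
    P₁ + (at xs k + P₀)         ≡⟨ cong (P₁ +_) (trans (+-comm (at xs k) P₀) (sym (partialSum-suc xs k))) ⟩
    P₁ + P₁                     ∎
  where
  open ≤-Reasoning
  P₀ : ℕ
  P₀ = partialSum xs k
  P₁ : ℕ
  P₁ = partialSum xs (suc k)

increasing-⊓ : ∀ {f g} → Increasing f → Increasing g → Increasing (λ i → f i ⊓ g i)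
increasing-⊓ inc-f inc-g i = ⊓-mono-≤ (inc-f i) (inc-g i)

increasing-+ : ∀ {f} → Increasing f → ∀ e → Increasing (λ i → f i + e)
increasing-+ inc-f e i = +-monoˡ-≤ e (inc-f i)

concave-⊓ : ∀ {f g} → Concave f → Concave g → Concave (λ i → f i ⊓ g i)
concave-⊓ {f} {g} conc-f conc-g i with ≤-total (f (1 + i)) (g (1 + i))
... | inj₁ f≤g rewrite m≤n⇒m⊓n≡m f≤g =
  ≤-trans (+-mono-≤ (m⊓n≤m (f (2 + i)) (g (2 + i))) (m⊓n≤m (f i) (g i))) (conc-f i)
... | inj₂ g≤f rewrite m≥n⇒m⊓n≡n g≤f =
  ≤-trans (+-mono-≤ (m⊓n≤n (f (2 + i)) (g (2 + i))) (m⊓n≤n (f i) (g i))) (conc-g i)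

concave-+ : ∀ {f} → Concave f → ∀ e → Concave (λ i → f i + e)
concave-+ {f} conc-f e i = begin
    (f (2 + i) + e) + (f i + e)        ≡⟨ interchange (f (2 + i)) e (f i) e ⟩
    (f (2 + i) + f i) + (e + e)        ≤⟨ +-monoˡ-≤ (e + e) (conc-f i) ⟩
    (f (1 + i) + f (1 + i)) + (e + e)  ≡⟨ interchange (f (1 + i)) (f (1 + i)) e e ⟩
    (f (1 + i) + e) + (f (1 + i) + e)  ∎
  where open ≤-Reasoning

-- Partitions with a prescribed concave partial-sum function

differences : (ℕ → ℕ) → ℕ → List ℕ
differences f zero    = []
differences f (suc n) = (f 1 ∸ f 0) ∷ differences (f ∘ suc) n

partialSum-differences : ∀ {f} → Increasing f → ∀ n k → partialSum (differences f n) k + f 0 ≡ f (k ⊓ n)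
partialSum-differences inc n       zero    = refl
partialSum-differences inc zero    (suc k) = refl
partialSum-differences {f} inc (suc n) (suc k) = begin
    ((f 1 ∸ f 0) + P) + f 0  ≡⟨ xy∙z≈y∙xz (f 1 ∸ f 0) P (f 0) ⟩
    P + ((f 1 ∸ f 0) + f 0)  ≡⟨ cong (P +_) (m∸n+n≡m (inc 0)) ⟩
    P + f 1                  ≡⟨ partialSum-differences (inc ∘ suc) n k ⟩
    f (suc (k ⊓ n))          ∎
  where
  open ≡-Reasoning
  P : ℕ
  P = partialSum (differences (f ∘ suc) n) k

∸-concave : ∀ a b c → c + a ≤ b + b → c ∸ b ≤ b ∸ a
∸-concave a b c c+a≤b+b = begin
    c ∸ b                ≤⟨ ∸-monoˡ-≤ b (m+n≤o⇒m≤o∸n c c+a≤b+b) ⟩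
    ((b + b) ∸ a) ∸ b    ≡⟨ ∸-+-assoc (b + b) a b ⟩
    (b + b) ∸ (a + b)    ≡⟨ cong ((b + b) ∸_) (+-comm a b) ⟩
    (b + b) ∸ (b + a)    ≡⟨ [m+n]∸[m+o]≡n∸o b b a ⟩
    b ∸ a                ∎
  where open ≤-Reasoning

differences-decreasing : ∀ {f} → Concave f → ∀ n → Decreasing (differences f n)
differences-decreasing conc zero          = []
differences-decreasing conc (suc zero)    = [-]
differences-decreasing {f} conc (suc (suc n)) =
  ∸-concave (f 0) (f 1) (f 2) (conc 0) ∷ differences-decreasing {f ∘ suc} (conc ∘ suc) (suc n)

filter-positive-zeros : ∀ {xs} → All (_≤ 0) xs → filter (0 <?_) xs ≡ []
filter-positive-zeros []          = refl
filter-positive-zeros (z≤n ∷ xs≤0) = filter-positive-zeros xs≤0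

partialSum-zeros : ∀ {xs} → All (_≤ 0) xs → ∀ k → partialSum xs k ≡ 0
partialSum-zeros []           k       = partialSum-[] k
partialSum-zeros (_ ∷ _)      zero    = refl
partialSum-zeros (z≤n ∷ xs≤0) (suc k) = partialSum-zeros xs≤0 k

partialSum-filter-positive : ∀ {xs} → Decreasing xs → ∀ k → partialSum (filter (0 <?_) xs) k ≡ partialSum xs k
partialSum-filter-positive {[]}        dec k       = refl
partialSum-filter-positive {zero ∷ xs} dec k
  rewrite filter-positive-zeros (decreasing⇒bounded dec) =
  trans (partialSum-[] k) (sym (partialSum-zeros (decreasing⇒bounded dec) k))
partialSum-filter-positive {suc x ∷ xs} dec zero    = refl
partialSum-filter-positive {suc x ∷ xs} dec (suc k) =
  cong (suc x +_) (partialSum-filter-positive (Linked.tail dec) k)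

concavePartition : (f : ℕ → ℕ) → Concave f → ℕ → Partition
concavePartition f conc n = mkPartition (filter (0 <?_) ds) (all-filter (0 <?_) ds)
  (filter⁺ (0 <?_) (flip ≤-trans) (differences-decreasing conc n))
  where ds = differences f n

module _ {f : ℕ → ℕ} (f0≡0 : f 0 ≡ 0) (inc : Increasing f) (conc : Concave f) (n : ℕ) where

  partialSum-concavePartition : ∀ k → partialSum (parts (concavePartition f conc n)) k ≡ f (k ⊓ n)
  partialSum-concavePartition k = begin
    partialSum (filter (0 <?_) (differences f n)) k  ≡⟨ partialSum-filter-positive (differences-decreasing conc n) k ⟩
    partialSum (differences f n) k                   ≡⟨ +-identityʳ _ ⟨
    partialSum (differences f n) k + 0               ≡⟨ cong (partialSum (differences f n) k +_) f0≡0 ⟨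
    partialSum (differences f n) k + f 0             ≡⟨ partialSum-differences inc n k ⟩
    f (k ⊓ n)                                        ∎
    where open ≡-Reasoning

  ∣concavePartition∣ : ∣ concavePartition f conc n ∣ₚ ≡ f n
  ∣concavePartition∣ = begin
    sum ps                  ≡⟨ partialSum-all ps (m≤m+n (length ps) n) ⟨
    partialSum ps (len + n) ≡⟨ partialSum-concavePartition (len + n) ⟩
    f ((len + n) ⊓ n)       ≡⟨ cong f (m≥n⇒m⊓n≡n (m≤n+m n len)) ⟩
    f n                     ∎
    where
    open ≡-Reasoning
    ps : List ℕ
    ps = parts (concavePartition f conc n)
    len : ℕ
    len = length ps

-- Partial sums of the conjugate

capSum : ℕ → List ℕ → ℕ
capSum c xs = sum (map (_⊓ c) xs)

take-applyUpTo : ∀ {A : Set} (f : ℕ → A) c n → take c (applyUpTo f n) ≡ applyUpTo f (c ⊓ n)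
take-applyUpTo f zero    n       = refl
take-applyUpTo f (suc c) zero    = refl
take-applyUpTo f (suc c) (suc n) = cong (f 0 ∷_) (take-applyUpTo (f ∘ suc) c n)

sum-applyUpTo-0 : ∀ n → sum (applyUpTo (λ _ → 0) n) ≡ 0
sum-applyUpTo-0 zero    = refl
sum-applyUpTo-0 (suc n) = sum-applyUpTo-0 n

sum-applyUpTo-cong : ∀ {f g} → (∀ i → f i ≡ g i) → ∀ n → sum (applyUpTo f n) ≡ sum (applyUpTo g n)
sum-applyUpTo-cong f≗g zero    = refl
sum-applyUpTo-cong f≗g (suc n) = cong₂ _+_ (f≗g 0) (sum-applyUpTo-cong (f≗g ∘ suc) n)

sum-applyUpTo-+ : ∀ f g n →
  sum (applyUpTo (λ i → f i + g i) n) ≡ sum (applyUpTo f n) + sum (applyUpTo g n)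
sum-applyUpTo-+ f g zero    = refl
sum-applyUpTo-+ f g (suc n) =
  trans (cong (f 0 + g 0 +_) (sum-applyUpTo-+ (f ∘ suc) (g ∘ suc) n)) (interchange (f 0) (g 0) _ _)

indicator : ℕ → ℕ → ℕ
indicator i y = if does (suc i ≤? y) then 1 else 0

sum-applyUpTo-indicator : ∀ y n → sum (applyUpTo (λ i → indicator i y) n) ≡ y ⊓ n
sum-applyUpTo-indicator y       zero    = sym (⊓-zeroʳ y)
sum-applyUpTo-indicator zero    (suc n) = sum-applyUpTo-0 n
sum-applyUpTo-indicator (suc y) (suc n) = cong suc (sum-applyUpTo-indicator y n)

conjEntry : ℕ → List ℕ → ℕ
conjEntry i ys = length (filter (λ y → suc i ≤? y) ys)

conjEntry-∷ : ∀ i y ys → conjEntry i (y ∷ ys) ≡ indicator i y + conjEntry i ys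
conjEntry-∷ i y ys with does (suc i ≤? y)
... | true  = refl
... | false = refl

sum-applyUpTo-conjEntry : ∀ ys n → sum (applyUpTo (λ i → conjEntry i ys) n) ≡ capSum n ys
sum-applyUpTo-conjEntry []       n = sum-applyUpTo-0 n
sum-applyUpTo-conjEntry (y ∷ ys) n = begin
    sum (applyUpTo (λ i → conjEntry i (y ∷ ys)) n)             ≡⟨ sum-applyUpTo-cong (λ i → conjEntry-∷ i y ys) n ⟩
    sum (applyUpTo (λ i → indicator i y + conjEntry i ys) n)   ≡⟨ sum-applyUpTo-+ _ _ n ⟩
    sum (applyUpTo (λ i → indicator i y) n) + sum (applyUpTo (λ i → conjEntry i ys) n)
      ≡⟨ cong₂ _+_ (sum-applyUpTo-indicator y n) (sum-applyUpTo-conjEntry ys n) ⟩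
    y ⊓ n + capSum n ys                                         ∎
  where open ≡-Reasoning

capSum-⊓ : ∀ {x} c {ys} → All (_≤ x) ys → capSum (c ⊓ x) ys ≡ capSum c ys
capSum-⊓     c []                    = refl
capSum-⊓ {x} c {y ∷ _} (y≤x ∷ ys≤x) = cong₂ _+_ y⊓[c⊓x]≡y⊓c (capSum-⊓ c ys≤x)
  where
  y⊓[c⊓x]≡y⊓c : y ⊓ (c ⊓ x) ≡ y ⊓ c
  y⊓[c⊓x]≡y⊓c = begin
    y ⊓ (c ⊓ x)  ≡⟨ cong (y ⊓_) (⊓-comm c x) ⟩
    y ⊓ (x ⊓ c)  ≡⟨ ⊓-assoc y x c ⟨
    (y ⊓ x) ⊓ c  ≡⟨ cong (_⊓ c) (m≤n⇒m⊓n≡m y≤x) ⟩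
    y ⊓ c        ∎
    where open ≡-Reasoning

partialSum-conjParts : ∀ {xs} → Decreasing xs → ∀ c → partialSum (conjParts xs) c ≡ capSum c xs
partialSum-conjParts {[]}     _   c = partialSum-[] c
partialSum-conjParts {x ∷ xs} dec c = begin
    sum (take c (map column (upTo x)))  ≡⟨ cong (sum ∘ take c) (map-upTo column x) ⟩
    sum (take c (applyUpTo column x))   ≡⟨ cong sum (take-applyUpTo column c x) ⟩
    sum (applyUpTo column (c ⊓ x))      ≡⟨ sum-applyUpTo-conjEntry (x ∷ xs) (c ⊓ x) ⟩
    capSum (c ⊓ x) (x ∷ xs)             ≡⟨ capSum-⊓ c (decreasing⇒bounded dec) ⟩
    capSum c (x ∷ xs)                   ∎
  where
  open ≡-Reasoning
  column : ℕ → ℕ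
  column i = conjEntry i (x ∷ xs)

capSum≤sum : ∀ c xs → capSum c xs ≤ sum xs
capSum≤sum c []       = z≤n
capSum≤sum c (x ∷ xs) = +-mono-≤ (m⊓n≤m x c) (capSum≤sum c xs)

capSum-bounded : ∀ {c xs} → All (_≤ c) xs → capSum c xs ≡ sum xs
capSum-bounded []             = refl
capSum-bounded (x≤c ∷ xs≤c) = cong₂ _+_ (m≤n⇒m⊓n≡m x≤c) (capSum-bounded xs≤c)

capSum-0 : ∀ xs → capSum 0 xs ≡ 0
capSum-0 []       = refl
capSum-0 (x ∷ xs) = trans (cong (_+ capSum 0 xs) (⊓-zeroʳ x)) (capSum-0 xs)

at-bounded : ∀ {b xs} → All (_≤ b) xs → ∀ k → at xs k ≤ b
at-bounded []          k       = z≤n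
at-bounded (x≤b ∷ _)   zero    = x≤b
at-bounded (_ ∷ xs≤b) (suc k) = at-bounded xs≤b k

capSum+partialSum≤ : ∀ c xs k → capSum c xs + partialSum xs k ≤ k * c + sum xs
capSum+partialSum≤ c []       zero    = z≤n
capSum+partialSum≤ c []       (suc k) = z≤n
capSum+partialSum≤ c (x ∷ xs) zero    = ≤-trans (≤-reflexive (+-identityʳ _)) (capSum≤sum c (x ∷ xs))
capSum+partialSum≤ c (x ∷ xs) (suc k) = begin
    (x ⊓ c + capSum c xs) + (x + partialSum xs k)  ≡⟨ interchange (x ⊓ c) _ x _ ⟩
    (x ⊓ c + x) + (capSum c xs + partialSum xs k)  ≤⟨ +-mono-≤ (+-monoˡ-≤ x (m⊓n≤n x c)) (capSum+partialSum≤ c xs k) ⟩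
    (c + x) + (k * c + sum xs)                     ≡⟨ interchange c x _ _ ⟩
    (c + k * c) + (x + sum xs)                     ∎
  where open ≤-Reasoning

capSum+partialSum-∷ : ∀ {c x xs k} → c ≤ x →
  capSum c xs + partialSum xs k ≡ k * c + sum xs →
  capSum c (x ∷ xs) + partialSum (x ∷ xs) (suc k) ≡ suc k * c + sum (x ∷ xs)
capSum+partialSum-∷ {c} {x} {xs} {k} c≤x eq = begin
    (x ⊓ c + capSum c xs) + (x + partialSum xs k)  ≡⟨ cong (λ z → (z + capSum c xs) + (x + partialSum xs k)) (m≥n⇒m⊓n≡n c≤x) ⟩
    (c + capSum c xs) + (x + partialSum xs k)      ≡⟨ interchange c _ x _ ⟩
    (c + x) + (capSum c xs + partialSum xs k)      ≡⟨ cong ((c + x) +_) eq ⟩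
    (c + x) + (k * c + sum xs)                     ≡⟨ interchange c x _ _ ⟩
    (c + k * c) + (x + sum xs)                     ∎
  where open ≡-Reasoning

capSum+partialSum-at : ∀ {xs} → Decreasing xs → ∀ k →
  capSum (at xs k) xs + partialSum xs k ≡ k * at xs k + sum xs
capSum+partialSum-at {[]}     _   k       = trans (partialSum-[] k) (sym (trans (+-identityʳ _) (*-zeroʳ k)))
capSum+partialSum-at {x ∷ xs} dec zero    = trans (+-identityʳ _) (capSum-bounded (decreasing⇒bounded dec))
capSum+partialSum-at {x ∷ xs} dec (suc k) =
  capSum+partialSum-∷ {xs = xs} {k} (at-bounded (decreasing⇒bounded dec) (suc k))
    (capSum+partialSum-at (Linked.tail dec) k)

capSum+partialSum-attained : ∀ {xs} → Decreasing xs → ∀ c →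
  ∃[ K ] capSum c xs + partialSum xs K ≡ K * c + sum xs
capSum+partialSum-attained {[]}     _   c = 0 , refl
capSum+partialSum-attained {x ∷ xs} dec c with c ≤? x
... | yes c≤x = let K , eq = capSum+partialSum-attained (Linked.tail dec) c
                in suc K , capSum+partialSum-∷ {xs = xs} {K} c≤x eq
... | no  c≰x = 0 , trans (+-identityʳ _)
                  (capSum-bounded (All.map (λ y≤x → ≤-trans y≤x (<⇒≤ (≰⇒> c≰x))) (decreasing⇒bounded dec)))

-- Conjugate dominance as dominance of tails

-- a ⊴ₜ b says |a| − P_a(k) ≤ |b| − P_b(k), with both sides moved to avoid subtraction.
_⊴ₜ_ : List ℕ → List ℕ → Set
a ⊴ₜ b = ∀ k → partialSum b k + sum a ≤ partialSum a k + sum b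

capSum-mono⇒⊴ₜ : ∀ {a b} → Decreasing a → (∀ c → capSum c a ≤ capSum c b) → a ⊴ₜ b
capSum-mono⇒⊴ₜ {a} {b} dec-a capSum-a≤b k = +-cancelʳ-≤ (k * c) _ _ (begin
    (Pb + sum a) + k * c    ≡⟨ xy∙z≈x∙zy Pb (sum a) (k * c) ⟩
    Pb + (k * c + sum a)    ≡⟨ cong (Pb +_) (capSum+partialSum-at dec-a k) ⟨
    Pb + (capSum c a + Pa)  ≤⟨ +-monoʳ-≤ Pb (+-monoˡ-≤ Pa (capSum-a≤b c)) ⟩
    Pb + (capSum c b + Pa)  ≡⟨ x∙yz≈z∙yx Pb _ Pa ⟩
    Pa + (capSum c b + Pb)  ≤⟨ +-monoʳ-≤ Pa (capSum+partialSum≤ c b k) ⟩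
    Pa + (k * c + sum b)    ≡⟨ x∙yz≈xz∙y Pa (k * c) (sum b) ⟩
    (Pa + sum b) + k * c    ∎)
  where
  open ≤-Reasoning
  c : ℕ
  c = at a k
  Pa : ℕ
  Pa = partialSum a k
  Pb : ℕ
  Pb = partialSum b k

⊴ₜ⇒capSum-mono : ∀ {a b} → Decreasing b → a ⊴ₜ b → ∀ c → capSum c a ≤ capSum c b
⊴ₜ⇒capSum-mono {a} {b} dec-b a⊴ₜb c with capSum+partialSum-attained dec-b c
... | K , eq = +-cancelʳ-≤ (Pa + sum b) _ _ (begin
    capSum c a + (Pa + sum b)   ≡⟨ +-assoc (capSum c a) Pa (sum b) ⟨
    (capSum c a + Pa) + sum b   ≤⟨ +-monoˡ-≤ (sum b) (capSum+partialSum≤ c a K) ⟩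
    (K * c + sum a) + sum b     ≡⟨ xy∙z≈xz∙y (K * c) (sum a) (sum b) ⟩
    (K * c + sum b) + sum a     ≡⟨ cong (_+ sum a) eq ⟨
    (capSum c b + Pb) + sum a   ≡⟨ +-assoc (capSum c b) Pb (sum a) ⟩
    capSum c b + (Pb + sum a)   ≤⟨ +-monoʳ-≤ (capSum c b) (a⊴ₜb K) ⟩
    capSum c b + (Pa + sum b)   ∎)
  where
  open ≤-Reasoning
  Pa : ℕ
  Pa = partialSum a K
  Pb : ℕ
  Pb = partialSum b K

conjParts-⊴⇒⊴ₜ : ∀ {a b} → Decreasing a → Decreasing b → conjParts a ⊴ conjParts b → a ⊴ₜ b
conjParts-⊴⇒⊴ₜ {a} {b} dec-a dec-b a*⊴b* = capSum-mono⇒⊴ₜ dec-a capSum-a≤b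
  where
  capSum-a≤b : ∀ c → capSum c a ≤ capSum c b
  capSum-a≤b zero    = ≤-reflexive (trans (capSum-0 a) (sym (capSum-0 b)))
  capSum-a≤b (suc c) = subst₂ _≤_ (partialSum-conjParts dec-a (suc c)) (partialSum-conjParts dec-b (suc c))
                         (a*⊴b* (suc c) (s≤s z≤n))

⊴ₜ⇒conjParts-⊴ : ∀ {a b} → Decreasing a → Decreasing b → a ⊴ₜ b → conjParts a ⊴ conjParts b
⊴ₜ⇒conjParts-⊴ dec-a dec-b a⊴ₜb c _ =
  subst₂ _≤_ (sym (partialSum-conjParts dec-a c)) (sym (partialSum-conjParts dec-b c))
    (⊴ₜ⇒capSum-mono dec-b a⊴ₜb c)

-- The partition with partial sums min(P_μ, P_λ + e)

module Interpolation (l m : Partition) (e : ℕ) where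

  bound : ℕ → ℕ
  bound k = partialSum (parts m) k ⊓ (partialSum (parts l) k + e)

  private
    N : ℕ
    N = length (parts m) + length (parts l)

    bound-increasing : Increasing bound
    bound-increasing = increasing-⊓ {partialSum (parts m)} {λ k → partialSum (parts l) k + e}
      (partialSum-increasing (parts m)) (increasing-+ {partialSum (parts l)} (partialSum-increasing (parts l)) e)

    bound-concave : Concave bound
    bound-concave = concave-⊓ {partialSum (parts m)} {λ k → partialSum (parts l) k + e}
      (partialSum-concave (decr m)) (concave-+ {partialSum (parts l)} (partialSum-concave (decr l)) e)

  interpolant : Partition
  interpolant = concavePartition bound bound-concave N

  partialSum-interpolant : ∀ k → partialSum (parts interpolant) k ≡ bound k
  partialSum-interpolant k = trans (partialSum-concavePartition refl bound-increasing bound-concave N k)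
    (cong₂ (λ Pm Pl → Pm ⊓ (Pl + e)) (partialSum-⊓ (parts m) {N} (m≤m+n _ _) k) (partialSum-⊓ (parts l) {N} (m≤n+m _ _) k))

  ∣interpolant∣ : ∣ l ∣ₚ + e ≤ ∣ m ∣ₚ → ∣ interpolant ∣ₚ ≡ ∣ l ∣ₚ + e
  ∣interpolant∣ ∣l∣+e≤∣m∣ = begin
    ∣ interpolant ∣ₚ               ≡⟨ ∣concavePartition∣ refl bound-increasing bound-concave N ⟩
    bound N                        ≡⟨ cong₂ (λ Pm Pl → Pm ⊓ (Pl + e)) (partialSum-all (parts m) {N} (m≤m+n _ _))
                                                                     (partialSum-all (parts l) {N} (m≤n+m _ _)) ⟩
    ∣ m ∣ₚ ⊓ (∣ l ∣ₚ + e)          ≡⟨ m≥n⇒m⊓n≡n ∣l∣+e≤∣m∣ ⟩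
    ∣ l ∣ₚ + e                     ∎
    where open ≡-Reasoning

  ⊴-interpolant : parts l ⊴ parts m → parts l ⊴ parts interpolant
  ⊴-interpolant l⊴m k k≥1 = subst (partialSum (parts l) k ≤_) (sym (partialSum-interpolant k))
    (⊓-glb (l⊴m k k≥1) (m≤m+n _ e))

  interpolant-⊴ : parts interpolant ⊴ parts m
  interpolant-⊴ k _ = subst (_≤ partialSum (parts m) k) (sym (partialSum-interpolant k)) (m⊓n≤m _ _)

  ⊴ₜ-interpolant : ∣ l ∣ₚ + e ≤ ∣ m ∣ₚ → parts l ⊴ₜ parts interpolant
  ⊴ₜ-interpolant ∣l∣+e≤∣m∣ k = begin
    partialSum (parts interpolant) k + ∣ l ∣ₚ  ≡⟨ cong (_+ ∣ l ∣ₚ) (partialSum-interpolant k) ⟩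
    bound k + ∣ l ∣ₚ                            ≤⟨ +-monoˡ-≤ ∣ l ∣ₚ (m⊓n≤n _ _) ⟩
    (Pl + e) + ∣ l ∣ₚ                           ≡⟨ xy∙z≈x∙zy Pl e ∣ l ∣ₚ ⟩
    Pl + (∣ l ∣ₚ + e)                           ≡⟨ cong (Pl +_) (∣interpolant∣ ∣l∣+e≤∣m∣) ⟨
    Pl + ∣ interpolant ∣ₚ                       ∎
    where
    open ≤-Reasoning
    Pl : ℕ
    Pl = partialSum (parts l) k

  interpolant-⊴ₜ : parts l ⊴ₜ parts m → ∣ l ∣ₚ + e + 1 ≡ ∣ m ∣ₚ → parts interpolant ⊴ₜ parts m
  interpolant-⊴ₜ l⊴ₜm size k = begin
    Pm + ∣ interpolant ∣ₚ               ≤⟨ +-monoˡ-≤ _ Pm≤bound+1 ⟩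
    (bound k + 1) + ∣ interpolant ∣ₚ    ≡⟨ cong ((bound k + 1) +_) (∣interpolant∣ ∣l∣+e≤∣m∣) ⟩
    (bound k + 1) + (∣ l ∣ₚ + e)        ≡⟨ trans (+-assoc (bound k) 1 _) (cong (bound k +_) (trans (+-comm 1 _) size)) ⟩
    bound k + ∣ m ∣ₚ                    ≡⟨ cong (_+ ∣ m ∣ₚ) (partialSum-interpolant k) ⟨
    partialSum (parts interpolant) k + ∣ m ∣ₚ ∎
    where
    open ≤-Reasoning
    Pm : ℕ
    Pm = partialSum (parts m) k
    Pl : ℕ
    Pl = partialSum (parts l) k
    ∣l∣+e≤∣m∣ : ∣ l ∣ₚ + e ≤ ∣ m ∣ₚ
    ∣l∣+e≤∣m∣ = subst (∣ l ∣ₚ + e ≤_) size (m≤m+n _ 1)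
    Pm≤Pl+e+1 : Pm ≤ Pl + e + 1
    Pm≤Pl+e+1 = +-cancelʳ-≤ ∣ l ∣ₚ _ _ (begin
      Pm + ∣ l ∣ₚ                  ≤⟨ l⊴ₜm k ⟩
      Pl + ∣ m ∣ₚ                  ≡⟨ cong (Pl +_) size ⟨
      Pl + (∣ l ∣ₚ + e + 1)        ≡⟨ cong (Pl +_) (+-assoc ∣ l ∣ₚ e 1) ⟩
      Pl + (∣ l ∣ₚ + (e + 1))      ≡⟨ x∙yz≈xz∙y Pl ∣ l ∣ₚ (e + 1) ⟩
      (Pl + (e + 1)) + ∣ l ∣ₚ      ≡⟨ cong (_+ ∣ l ∣ₚ) (+-assoc Pl e 1) ⟨
      (Pl + e + 1) + ∣ l ∣ₚ        ∎)
    Pm≤bound+1 : Pm ≤ bound k + 1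
    Pm≤bound+1 = subst (Pm ≤_) (sym (+-distribʳ-⊓ 1 Pm (Pl + e))) (⊓-glb (m≤m+n Pm 1) Pm≤Pl+e+1)

proposition3 : (l m : Partition) → l ⊑ m → suc ∣ l ∣ₚ < ∣ m ∣ₚ →
    Σ Partition (λ m′ → (l ⊑ m′) × (m′ ⊑ m) × (∣ m′ ∣ₚ + 1 ≡ ∣ m ∣ₚ))
proposition3 l m (l⊴m , l*⊴m*) ∣l∣+1<∣m∣ =
  interpolant ,
  (⊴-interpolant l⊴m , ⊴ₜ⇒conjParts-⊴ (decr l) (decr interpolant) (⊴ₜ-interpolant ∣l∣+e≤∣m∣)) ,
  (interpolant-⊴ , ⊴ₜ⇒conjParts-⊴ (decr interpolant) (decr m) (interpolant-⊴ₜ l⊴ₜm size)) ,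
  trans (cong (_+ 1) (∣interpolant∣ ∣l∣+e≤∣m∣)) size
  where
  e : ℕ
  e = ∣ m ∣ₚ ∸ suc ∣ l ∣ₚ
  open Interpolation l m e

  size : ∣ l ∣ₚ + e + 1 ≡ ∣ m ∣ₚ
  size = trans (+-comm (∣ l ∣ₚ + e) 1) (m+[n∸m]≡n (<⇒≤ ∣l∣+1<∣m∣))

  ∣l∣+e≤∣m∣ : ∣ l ∣ₚ + e ≤ ∣ m ∣ₚ
  ∣l∣+e≤∣m∣ = subst (∣ l ∣ₚ + e ≤_) size (m≤m+n _ 1)

  l⊴ₜm : parts l ⊴ₜ parts m
  l⊴ₜm = conjParts-⊴⇒⊴ₜ (decr l) (decr m) l*⊴m*
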